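{- For every positive integer $n$, with $i=\sqrt{ -1}$, $$\sum_{\substack{1\le k\le n\\ 4\mid k}}\binom nkB_{n-k}(x)\big((-1)^{\frac k4}2^{\frac k2-1}-1\big)=\frac n8\Big\{2(x-1)^{n-1}-2x^{n-1}+(x+i)^{n-1}+(x-i)^{n-1}-(x-1+i)^{n-1}-(x-1-i)^{n-1}\Big\}.$$
   Context: The Bernoulli numbers $B_n$ are defined by $B_0=1$ and $\sum_{k=0}^{n-1}\binom nkB_k=0$ for $n\ge 2$; the Bernoulli polynomials are $B_n(x)=\sum_{k=0}^n\binom nkB_kx^{n-k}$ for $n\ge 0$. -}

module Defs where

open import Data.Nat as ℕ using (ℕ; zero; suc; _∸_)
open import Data.Nat.Combinatorics using (_C_)
open import Data.Nat.Divisibility using (_∣?_)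
open import Data.Integer using (+_)
open import Data.Rational as ℚ using (ℚ; _+_; _*_; -_; _-_; _/_; 0ℚ; 1ℚ)
open import Data.Bool using (if_then_else_; _∧_)
open import Relation.Nullary using (does)

ℕ→ℚ : ℕ → ℚ
ℕ→ℚ n = + n / 1

_^ℚ_ : ℚ → ℕ → ℚ
x ^ℚ zero = 1ℚ
x ^ℚ suc n = x * (x ^ℚ n)

sumTo : ℕ → (ℕ → ℚ) → ℚ
sumTo zero f = f 0
sumTo (suc n) f = sumTo n f + f (suc n)

-- B is a Bernoulli sequence: B 0 = 1 and Σ_{k=0}^{n-1} (n choose k) B k = 0 for n ≥ 2
IsBernoulli : (ℕ → ℚ) → Set
IsBernoulli B = (B 0 ≡ 1ℚ) × ((m : ℕ) → sumTo (suc m) (λ k → ℕ→ℚ (suc (suc m) C k) * B k) ≡ 0ℚ)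
  where open import Relation.Binary.PropositionalEquality using (_≡_)
        open import Data.Product using (_×_)

bernPoly : (ℕ → ℚ) → ℕ → ℚ → ℚ
bernPoly B n x = sumTo n (λ k → ℕ→ℚ (n C k) * B k * (x ^ℚ (n ∸ k)))

record ℚi : Set where
  constructor _+i_
  field
    re : ℚ
    im : ℚ

open ℚi public

infixl 6 _+ᶜ_ _-ᶜ_
infixl 7 _*ᶜ_

_+ᶜ_ : ℚi → ℚi → ℚi
(a +i b) +ᶜ (c +i d) = (a + c) +i (b + d)

_-ᶜ_ : ℚi → ℚi → ℚi
(a +i b) -ᶜ (c +i d) = (a - c) +i (b - d)

_*ᶜ_ : ℚi → ℚi → ℚi
(a +i b) *ᶜ (c +i d) = (a * c - b * d) +i (a * d + b * c)

_^ᶜ_ : ℚi → ℕ → ℚi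
z ^ᶜ zero = 1ℚ +i 0ℚ
z ^ᶜ suc n = z *ᶜ (z ^ᶜ n)

ι : ℚ → ℚi
ι q = q +i 0ℚ

iᶜ : ℚi
iᶜ = 0ℚ +i 1ℚ

sel : ℕ → ℚ → ℚ
sel k q = if does (1 ℕ.≤? k) ∧ does (4 ∣? k) then q else 0ℚ

lhs : (ℕ → ℚ) → ℕ → ℚ → ℚ
lhs B n x = sumTo n (λ k → sel k
  (ℕ→ℚ (n C k) * bernPoly B (n ∸ k) x
    * (((- 1ℚ) ^ℚ (k ℕ./ 4)) * (ℕ→ℚ 2 ^ℚ ((k ℕ./ 2) ∸ 1)) - 1ℚ)))

rhs : ℕ → ℚ → ℚi
rhs n x = ι (ℕ→ℚ n * (+ 1 / 8)) *ᶜ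
  ( ι 2q *ᶜ ((X -ᶜ one) ^ᶜ m) -ᶜ ι 2q *ᶜ (X ^ᶜ m)
    +ᶜ (X +ᶜ iᶜ) ^ᶜ m +ᶜ (X -ᶜ iᶜ) ^ᶜ m
    -ᶜ (X -ᶜ one +ᶜ iᶜ) ^ᶜ m -ᶜ (X -ᶜ one -ᶜ iᶜ) ^ᶜ m )
  where
    X = ι x
    one = ι 1ℚ
    2q = ℕ→ℚ 2
    m = n ∸ 1

-- Put ζ = 1 + i, so that ζ⁴ = −4 and (−1)^(k/4) 2^(k/2−1) = ζᵏ/2 when 4 ∣ k. As ∑_{r⁴=1} rᵏ = 4·[4 ∣ k],
-- the left-hand side together with its missing term k = 0 is ∑ₖ C(n,k) B_{n−k}(x) (⅛ ∑ᵣ (rζ)ᵏ − ¼ ∑ᵣ rᵏ),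
-- which the addition theorem B_n(x + w) = ∑ₖ C(n,k) B_{n−k}(x) wᵏ turns into ⅛ ∑ᵣ B_n(x + rζ) − ¼ ∑ᵣ B_n(x + r).
-- These eight arguments are x ± 1 ± i, x ± 1 and x ± i; the difference equation B_n(z + 1) − B_n(z) = n zⁿ⁻¹
-- brings all of them down to x − 1 and x − 1 ± i, leaving −½ B_n(x) and the powers on the right-hand side.

module Submission where

open import Defs
open import Data.Bool using (if_then_else_)
open import Data.Fin using (toℕ)
open import Data.Integer as ℤ using (+_)
import Data.Integer.Properties as ℤ
open import Data.Nat as ℕ using (ℕ; zero; suc; _!; _≤_; _<_; z≤n; s≤s; _∸_; _≤?_)
import Data.Nat.Properties as ℕ
open import Data.Nat.Combinatorics using (_C_; nCn≡1; nC1≡n; nCk≡nC[n∸k]; nCk≡n!/k![n-k]!; k![n∸k]!∣n!)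
open import Data.Nat.Divisibility using (_∣_; _∣?_; divides; ∣-refl; ∣m∣n⇒∣m+n; ∣m+n∣m⇒∣n)
open import Data.Nat.DivMod using (m/n*n≡m; m*n/n≡m)
open import Data.Nat.Tactic.RingSolver using () renaming (solve-∀ to ℕ-solve-∀)
open import Data.Product using (_,_)
open import Data.Rational as ℚ using (ℚ; 0ℚ; 1ℚ)
import Data.Rational.Properties as ℚ
open import Data.Rational.Solver using (module +-*-Solver)
import Data.Rational.Unnormalised as ℚᵘ
import Data.Rational.Unnormalised.Properties as ℚᵘ
open import Data.Sum using (inj₁; inj₂)
open import Function.Bundles using (mk⇔)
open import Relation.Binary.Definitions using (DecidableEquality)
open import Relation.Binary.PropositionalEquality
open import Relation.Nullary using (Dec; does; yes; no; contradiction)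
open import Relation.Nullary.Decidable using (dec-true; dec-false; map′; _×-dec_; dec⇒maybe; does-⇔)
open import Algebra.Bundles using (CommutativeRing)
open import Algebra.Structures {A = ℚi} _≡_ using (IsCommutativeRing)
import Tactic.RingSolver.Core.AlmostCommutativeRing as ACR
open import Tactic.RingSolver using (solve-∀)

open +-*-Solver using (solve; _:+_; _:-_; _:*_; _:=_; con)

-- ℚ(i) as a commutative ring

negᶜ : ℚi → ℚi
negᶜ (a +i b) = (ℚ.- a) +i (ℚ.- b)

0ᶜ 1ᶜ : ℚi
0ᶜ = ι 0ℚ
1ᶜ = ι 1ℚ

ℚi-isCommutativeRing : IsCommutativeRing _+ᶜ_ _*ᶜ_ negᶜ 0ᶜ 1ᶜ
ℚi-isCommutativeRing = record
  { isRing = record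
    { +-isAbelianGroup = record
      { isGroup = record
        { isMonoid = record
          { isSemigroup = record
            { isMagma = record { isEquivalence = isEquivalence ; ∙-cong = cong₂ _+ᶜ_ }
            ; assoc = λ (a +i b) (c +i d) (e +i f) → cong₂ _+i_ (ℚ.+-assoc a c e) (ℚ.+-assoc b d f) }
          ; identity = (λ (a +i b) → cong₂ _+i_ (ℚ.+-identityˡ a) (ℚ.+-identityˡ b))
                     , (λ (a +i b) → cong₂ _+i_ (ℚ.+-identityʳ a) (ℚ.+-identityʳ b)) }
        ; inverse = (λ (a +i b) → cong₂ _+i_ (ℚ.+-inverseˡ a) (ℚ.+-inverseˡ b))
                  , (λ (a +i b) → cong₂ _+i_ (ℚ.+-inverseʳ a) (ℚ.+-inverseʳ b))
        ; ⁻¹-cong = cong negᶜ }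
      ; comm = λ (a +i b) (c +i d) → cong₂ _+i_ (ℚ.+-comm a c) (ℚ.+-comm b d) }
    ; *-cong = cong₂ _*ᶜ_
    ; *-assoc = λ (a +i b) (c +i d) (e +i f) → cong₂ _+i_
        (solve 6 (λ a b c d e f → (a :* c :- b :* d) :* e :- (a :* d :+ b :* c) :* f
                               := a :* (c :* e :- d :* f) :- b :* (c :* f :+ d :* e)) refl a b c d e f)
        (solve 6 (λ a b c d e f → (a :* c :- b :* d) :* f :+ (a :* d :+ b :* c) :* e
                               := a :* (c :* f :+ d :* e) :+ b :* (c :* e :- d :* f)) refl a b c d e f)
    ; *-identity = (λ (a +i b) → cong₂ _+i_
                     (solve 2 (λ a b → con 1ℚ :* a :- con 0ℚ :* b := a) refl a b)
                     (solve 2 (λ a b → con 1ℚ :* b :+ con 0ℚ :* a := b) refl a b))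
                 , (λ (a +i b) → cong₂ _+i_
                     (solve 2 (λ a b → a :* con 1ℚ :- b :* con 0ℚ := a) refl a b)
                     (solve 2 (λ a b → a :* con 0ℚ :+ b :* con 1ℚ := b) refl a b))
    ; distrib = (λ (a +i b) (c +i d) (e +i f) → cong₂ _+i_
                  (solve 6 (λ a b c d e f → a :* (c :+ e) :- b :* (d :+ f)
                                         := (a :* c :- b :* d) :+ (a :* e :- b :* f)) refl a b c d e f)
                  (solve 6 (λ a b c d e f → a :* (d :+ f) :+ b :* (c :+ e)
                                         := (a :* d :+ b :* c) :+ (a :* f :+ b :* e)) refl a b c d e f))
              , (λ (a +i b) (c +i d) (e +i f) → cong₂ _+i_
                  (solve 6 (λ a b c d e f → (c :+ e) :* a :- (d :+ f) :* b
                                         := (c :* a :- d :* b) :+ (e :* a :- f :* b)) refl a b c d e f)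
                  (solve 6 (λ a b c d e f → (c :+ e) :* b :+ (d :+ f) :* a
                                         := (c :* b :+ d :* a) :+ (e :* b :+ f :* a)) refl a b c d e f)) }
  ; *-comm = λ (a +i b) (c +i d) → cong₂ _+i_
      (solve 4 (λ a b c d → a :* c :- b :* d := c :* a :- d :* b) refl a b c d)
      (solve 4 (λ a b c d → a :* d :+ b :* c := c :* b :+ d :* a) refl a b c d) }

ℚi-commutativeRing : CommutativeRing _ _
ℚi-commutativeRing = record { isCommutativeRing = ℚi-isCommutativeRing }

_≟ᶜ_ : DecidableEquality ℚi
(a +i b) ≟ᶜ (c +i d) = map′ (λ (a≡c , b≡d) → cong₂ _+i_ a≡c b≡d) (λ { refl → refl , refl })
                            ((a ℚ.≟ c) ×-dec (b ℚ.≟ d))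

-- The solver's coefficient ring is ℚ(i) itself, so it needs a genuine zero test to normalise.
ℚi-ring : ACR.AlmostCommutativeRing _ _
ℚi-ring = ACR.fromCommutativeRing ℚi-commutativeRing (λ z → dec⇒maybe (0ᶜ ≟ᶜ z))

open CommutativeRing ℚi-commutativeRing
  using (+-group; semiring; commutativeSemiring; +-rawMonoid)
  renaming ( *-identityˡ to *ᶜ-identityˡ; +-identityˡ to +ᶜ-identityˡ; +-identityʳ to +ᶜ-identityʳ
           ; *-identityʳ to *ᶜ-identityʳ; +-assoc to +ᶜ-assoc; +-comm to +ᶜ-comm; *-comm to *ᶜ-comm; distribˡ to *ᶜ-distribˡ-+ᶜ
           ; zeroˡ to *ᶜ-zeroˡ; zeroʳ to *ᶜ-zeroʳ)
open import Algebra.Definitions.RawMonoid +-rawMonoid using (_×_; sum)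
open import Algebra.Properties.Semiring.Exp semiring using (_^_)
open import Algebra.Properties.Semiring.Mult semiring using (×1-homo-*; ×-assoc-*)
open import Algebra.Properties.CommutativeSemiring.Exp commutativeSemiring using (^-distrib-*)
import Algebra.Properties.CommutativeSemiring.Binomial commutativeSemiring as Binomial
open import Algebra.Properties.Group +-group using () renaming (∙-cancelˡ to +ᶜ-cancelˡ)

^ᶜ≡^ : ∀ z n → z ^ᶜ n ≡ z ^ n
^ᶜ≡^ z zero = refl
^ᶜ≡^ z (suc n) = cong (z *ᶜ_) (^ᶜ≡^ z n)

^ᶜ-distrib-*ᶜ : ∀ z w n → (z *ᶜ w) ^ᶜ n ≡ z ^ᶜ n *ᶜ w ^ᶜ n
^ᶜ-distrib-*ᶜ z w n = begin
  (z *ᶜ w) ^ᶜ n      ≡⟨ ^ᶜ≡^ (z *ᶜ w) n ⟩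
  (z *ᶜ w) ^ n       ≡⟨ ^-distrib-* z w n ⟩
  z ^ n *ᶜ w ^ n     ≡⟨ sym (cong₂ _*ᶜ_ (^ᶜ≡^ z n) (^ᶜ≡^ w n)) ⟩
  z ^ᶜ n *ᶜ w ^ᶜ n   ∎
  where open ≡-Reasoning

1ᶜ^n≡1ᶜ : ∀ n → 1ᶜ ^ᶜ n ≡ 1ᶜ
1ᶜ^n≡1ᶜ zero = refl
1ᶜ^n≡1ᶜ (suc n) = trans (cong (1ᶜ *ᶜ_) (1ᶜ^n≡1ᶜ n)) (*ᶜ-identityˡ 1ᶜ)

fromℕ : ℕ → ℚi
fromℕ n = ι (ℕ→ℚ n)

-- Addition in ℚ normalises by a gcd that is stuck on a variable numerator, so compare in ℚᵘ.
ℕ→ℚ-suc : ∀ n → ℕ→ℚ (suc n) ≡ 1ℚ ℚ.+ ℕ→ℚ n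
ℕ→ℚ-suc n = ℚ.toℚᵘ-injective (ℚᵘ.≃-trans (ℚ.toℚᵘ-fromℚᵘ (ℚᵘ.mkℚᵘ (+ suc n) 0))
  (ℚᵘ.≃-sym (ℚᵘ.≃-trans (ℚ.toℚᵘ-homo-+ 1ℚ (ℕ→ℚ n))
    (ℚᵘ.≃-trans (ℚᵘ.+-congʳ (ℚᵘ.mkℚᵘ (+ 1) 0) (ℚ.toℚᵘ-fromℚᵘ (ℚᵘ.mkℚᵘ (+ n) 0)))
      (ℚᵘ.≃-reflexive (cong (λ m → ℚᵘ.mkℚᵘ (+ 1 ℤ.+ m) 0) (ℤ.*-identityʳ (+ n))))))))

fromℕ≡×1ᶜ : ∀ n → fromℕ n ≡ n × 1ᶜ
fromℕ≡×1ᶜ zero = refl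
fromℕ≡×1ᶜ (suc n) = trans (cong ι (ℕ→ℚ-suc n)) (cong (1ᶜ +ᶜ_) (fromℕ≡×1ᶜ n))

fromℕ-homo-* : ∀ m n → fromℕ (m ℕ.* n) ≡ fromℕ m *ᶜ fromℕ n
fromℕ-homo-* m n = begin
  fromℕ (m ℕ.* n)          ≡⟨ fromℕ≡×1ᶜ (m ℕ.* n) ⟩
  (m ℕ.* n) × 1ᶜ           ≡⟨ ×1-homo-* m n ⟩
  (m × 1ᶜ) *ᶜ (n × 1ᶜ)     ≡⟨ sym (cong₂ _*ᶜ_ (fromℕ≡×1ᶜ m) (fromℕ≡×1ᶜ n)) ⟩
  fromℕ m *ᶜ fromℕ n       ∎
  where open ≡-Reasoning

×≡fromℕ*ᶜ : ∀ n z → n × z ≡ fromℕ n *ᶜ z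
×≡fromℕ*ᶜ n z = begin
  n × z                ≡⟨ cong (n ×_) (sym (*ᶜ-identityˡ z)) ⟩
  n × (1ᶜ *ᶜ z)        ≡⟨ sym (×-assoc-* n 1ᶜ z) ⟩
  (n × 1ᶜ) *ᶜ z        ≡⟨ cong (_*ᶜ z) (sym (fromℕ≡×1ᶜ n)) ⟩
  fromℕ n *ᶜ z         ∎
  where open ≡-Reasoning

ι-* : ∀ p q → ι (p ℚ.* q) ≡ ι p *ᶜ ι q
ι-* p q = cong₂ _+i_ (solve 2 (λ p q → p :* q := p :* q :- con 0ℚ :* con 0ℚ) refl p q)
                     (solve 2 (λ p q → con 0ℚ := p :* con 0ℚ :+ con 0ℚ :* q) refl p q)

ι-^ : ∀ p n → ι (p ^ℚ n) ≡ ι p ^ᶜ n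
ι-^ p zero = refl
ι-^ p (suc n) = trans (ι-* p (p ^ℚ n)) (cong (ι p *ᶜ_) (ι-^ p n))

sumToᶜ : ℕ → (ℕ → ℚi) → ℚi
sumToᶜ zero f = f 0
sumToᶜ (suc n) f = sumToᶜ n f +ᶜ f (suc n)

syntax sumToᶜ n (λ k → e) = ∑[ k ≤ n ] e

ι-sumTo : ∀ n f → ι (sumTo n f) ≡ ∑[ k ≤ n ] ι (f k)
ι-sumTo zero f = refl
ι-sumTo (suc n) f = cong (_+ᶜ ι (f (suc n))) (ι-sumTo n f)

sumToᶜ-cong : ∀ n {f g : ℕ → ℚi} → (∀ k → k ≤ n → f k ≡ g k) → sumToᶜ n f ≡ sumToᶜ n g
sumToᶜ-cong zero f≡g = f≡g 0 z≤n
sumToᶜ-cong (suc n) f≡g =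
  cong₂ _+ᶜ_ (sumToᶜ-cong n (λ k k≤n → f≡g k (ℕ.m≤n⇒m≤1+n k≤n))) (f≡g (suc n) ℕ.≤-refl)

sumToᶜ-zero : ∀ n {f : ℕ → ℚi} → (∀ k → k ≤ n → f k ≡ 0ᶜ) → sumToᶜ n f ≡ 0ᶜ
sumToᶜ-zero zero f≡0 = f≡0 0 z≤n
sumToᶜ-zero (suc n) f≡0 = trans
  (cong₂ _+ᶜ_ (sumToᶜ-zero n (λ k k≤n → f≡0 k (ℕ.m≤n⇒m≤1+n k≤n))) (f≡0 (suc n) ℕ.≤-refl))
  (+ᶜ-identityʳ 0ᶜ)

sumToᶜ-suc : ∀ n (f : ℕ → ℚi) → ∑[ k ≤ suc n ] f k ≡ f 0 +ᶜ ∑[ k ≤ n ] f (suc k)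
sumToᶜ-suc zero f = refl
sumToᶜ-suc (suc n) f = trans (cong (_+ᶜ f (suc (suc n))) (sumToᶜ-suc n f))
  (+ᶜ-assoc (f 0) (∑[ k ≤ n ] f (suc k)) (f (suc (suc n))))

sumToᶜ-+ : ∀ n (f g : ℕ → ℚi) → ∑[ k ≤ n ] (f k +ᶜ g k) ≡ sumToᶜ n f +ᶜ sumToᶜ n g
sumToᶜ-+ zero f g = refl
sumToᶜ-+ (suc n) f g = trans (cong (_+ᶜ (f (suc n) +ᶜ g (suc n))) (sumToᶜ-+ n f g))
                             (interchange (sumToᶜ n f) (sumToᶜ n g) (f (suc n)) (g (suc n)))
  where
  interchange : ∀ a b c d → (a +ᶜ b) +ᶜ (c +ᶜ d) ≡ (a +ᶜ c) +ᶜ (b +ᶜ d)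
  interchange = solve-∀ ℚi-ring

*ᶜ-distribˡ-sumToᶜ : ∀ n c (f : ℕ → ℚi) → c *ᶜ sumToᶜ n f ≡ ∑[ k ≤ n ] (c *ᶜ f k)
*ᶜ-distribˡ-sumToᶜ zero c f = refl
*ᶜ-distribˡ-sumToᶜ (suc n) c f =
  trans (*ᶜ-distribˡ-+ᶜ c (sumToᶜ n f) (f (suc n))) (cong (_+ᶜ c *ᶜ f (suc n)) (*ᶜ-distribˡ-sumToᶜ n c f))

*ᶜ-distribʳ-sumToᶜ : ∀ n c (f : ℕ → ℚi) → sumToᶜ n f *ᶜ c ≡ ∑[ k ≤ n ] (f k *ᶜ c)
*ᶜ-distribʳ-sumToᶜ n c f = trans (*ᶜ-comm (sumToᶜ n f) c) (trans (*ᶜ-distribˡ-sumToᶜ n c f)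
  (sumToᶜ-cong n (λ k _ → *ᶜ-comm c (f k))))

sumToᶜ-linear : ∀ n a c (f g : ℕ → ℚi) →
                ∑[ k ≤ n ] (a *ᶜ f k -ᶜ c *ᶜ g k) ≡ a *ᶜ sumToᶜ n f -ᶜ c *ᶜ sumToᶜ n g
sumToᶜ-linear zero a c f g = refl
sumToᶜ-linear (suc n) a c f g = trans (cong (_+ᶜ (a *ᶜ f (suc n) -ᶜ c *ᶜ g (suc n))) (sumToᶜ-linear n a c f g))
  (regroup a c (sumToᶜ n f) (sumToᶜ n g) (f (suc n)) (g (suc n)))
  where
  regroup : ∀ a c s t x y → (a *ᶜ s +ᶜ negᶜ (c *ᶜ t)) +ᶜ (a *ᶜ x +ᶜ negᶜ (c *ᶜ y))
                          ≡ a *ᶜ (s +ᶜ x) +ᶜ negᶜ (c *ᶜ (t +ᶜ y))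
  regroup = solve-∀ ℚi-ring

sumToᶜ-single : ∀ n {i} (f : ℕ → ℚi) → i ≤ n → (∀ k → k ≤ n → k ≢ i → f k ≡ 0ᶜ) →
                sumToᶜ n f ≡ f i
sumToᶜ-single zero f z≤n _ = refl
sumToᶜ-single (suc n) {i} f i≤1+n others with ℕ.m≤n⇒m<n∨m≡n i≤1+n
... | inj₁ (s≤s i≤n) = begin
  sumToᶜ n f +ᶜ f (suc n) ≡⟨ cong₂ _+ᶜ_ (sumToᶜ-single n f i≤n (λ k k≤n → others k (ℕ.m≤n⇒m≤1+n k≤n)))
                                       (others (suc n) ℕ.≤-refl (ℕ.>⇒≢ (s≤s i≤n))) ⟩
  f i +ᶜ 0ᶜ               ≡⟨ +ᶜ-identityʳ (f i) ⟩
  f i                     ∎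
  where open ≡-Reasoning
... | inj₂ refl = begin
  sumToᶜ n f +ᶜ f (suc n) ≡⟨ cong (_+ᶜ f (suc n)) (sumToᶜ-zero n (λ k k≤n → others k (ℕ.m≤n⇒m≤1+n k≤n) (ℕ.<⇒≢ (s≤s k≤n)))) ⟩
  0ᶜ +ᶜ f (suc n)         ≡⟨ +ᶜ-identityˡ (f (suc n)) ⟩
  f (suc n)               ∎
  where open ≡-Reasoning

sumToᶜ-differ : ∀ n {i} (f g : ℕ → ℚi) → i ≤ n → (∀ k → k ≤ n → k ≢ i → f k ≡ g k) →
                sumToᶜ n f ≡ sumToᶜ n g +ᶜ (f i -ᶜ g i)
sumToᶜ-differ n {i} f g i≤n others = begin
  sumToᶜ n f                                  ≡⟨ sumToᶜ-cong n (λ k _ → split (f k) (g k)) ⟩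
  ∑[ k ≤ n ] (g k +ᶜ (f k -ᶜ g k))            ≡⟨ sumToᶜ-+ n g (λ k → f k -ᶜ g k) ⟩
  sumToᶜ n g +ᶜ ∑[ k ≤ n ] (f k -ᶜ g k)       ≡⟨ cong (sumToᶜ n g +ᶜ_) (sumToᶜ-single n _ i≤n
                                                   (λ k k≤n k≢i → trans (cong (_-ᶜ g k) (others k k≤n k≢i)) (cancel (g k)))) ⟩
  sumToᶜ n g +ᶜ (f i -ᶜ g i)                  ∎
  where
  open ≡-Reasoning
  split : ∀ a b → a ≡ b +ᶜ (a +ᶜ negᶜ b)
  split = solve-∀ ℚi-ring
  cancel : ∀ a → a +ᶜ negᶜ a ≡ 0ᶜ
  cancel = solve-∀ ℚi-ring

sumToᶜ-truncate : ∀ n {m} (f : ℕ → ℚi) → m ≤ n → (∀ j → m < j → j ≤ n → f j ≡ 0ᶜ) →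
                  sumToᶜ n f ≡ sumToᶜ m f
sumToᶜ-truncate zero f z≤n _ = refl
sumToᶜ-truncate (suc n) {m} f m≤1+n beyond with ℕ.m≤n⇒m<n∨m≡n m≤1+n
... | inj₂ refl = refl
... | inj₁ (s≤s m≤n) = begin
  sumToᶜ n f +ᶜ f (suc n) ≡⟨ cong₂ _+ᶜ_ (sumToᶜ-truncate n f m≤n (λ j m<j j≤n → beyond j m<j (ℕ.m≤n⇒m≤1+n j≤n)))
                                       (beyond (suc n) (s≤s m≤n) ℕ.≤-refl) ⟩
  sumToᶜ m f +ᶜ 0ᶜ        ≡⟨ +ᶜ-identityʳ (sumToᶜ m f) ⟩
  sumToᶜ m f              ∎
  where open ≡-Reasoning

sumToᶜ-comm : ∀ m n (F : ℕ → ℕ → ℚi) →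
              ∑[ k ≤ m ] ∑[ j ≤ n ] F k j ≡ ∑[ j ≤ n ] ∑[ k ≤ m ] F k j
sumToᶜ-comm zero n F = refl
sumToᶜ-comm (suc m) n F = trans (cong (_+ᶜ sumToᶜ n (F (suc m))) (sumToᶜ-comm m n F))
                                (sym (sumToᶜ-+ n (λ j → ∑[ k ≤ m ] F k j) (F (suc m))))

sumToᶜ-triangle : ∀ n (F : ℕ → ℕ → ℚi) →
                  ∑[ k ≤ n ] ∑[ j ≤ n ∸ k ] F k j ≡ ∑[ j ≤ n ] ∑[ k ≤ n ∸ j ] F k j
sumToᶜ-triangle n F = begin
  ∑[ k ≤ n ] ∑[ j ≤ n ∸ k ] F k j          ≡⟨ sumToᶜ-cong n (λ k k≤n → restrict (F k) k≤n) ⟩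
  ∑[ k ≤ n ] ∑[ j ≤ n ] within j k (F k j) ≡⟨ sumToᶜ-comm n n _ ⟩
  ∑[ j ≤ n ] ∑[ k ≤ n ] within j k (F k j) ≡⟨ sumToᶜ-cong n (λ j _ → sumToᶜ-cong n (λ k _ →
                                                cong (λ m → if does (m ≤? n) then F k j else 0ᶜ) (ℕ.+-comm j k))) ⟩
  ∑[ j ≤ n ] ∑[ k ≤ n ] within k j (F k j) ≡⟨ sym (sumToᶜ-cong n (λ j j≤n → restrict (λ k → F k j) j≤n)) ⟩
  ∑[ j ≤ n ] ∑[ k ≤ n ∸ j ] F k j          ∎
  where
  open ≡-Reasoning
  within : ℕ → ℕ → ℚi → ℚi
  within i j z = if does (i ℕ.+ j ≤? n) then z else 0ᶜ
  restrict : ∀ {k} (G : ℕ → ℚi) → k ≤ n → ∑[ j ≤ n ∸ k ] G j ≡ ∑[ j ≤ n ] within j k (G j)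
  restrict {k} G k≤n = sym (trans
    (sumToᶜ-truncate n _ (ℕ.m∸n≤m n k) (λ j n∸k<j _ →
      cong (λ b → if b then G j else 0ᶜ) (dec-false (j ℕ.+ k ≤? n) (λ j+k≤n → ℕ.<⇒≱ n∸k<j (ℕ.m+n≤o⇒m≤o∸n j j+k≤n)))))
    (sumToᶜ-cong (n ∸ k) (λ j j≤n∸k →
      cong (λ b → if b then G j else 0ᶜ) (dec-true (j ℕ.+ k ≤? n) (ℕ.m≤o∸n⇒m+n≤o j k≤n j≤n∸k)))))

sumToᶜ≡sum : ∀ n (f : ℕ → ℚi) → sumToᶜ n f ≡ sum {suc n} (λ k → f (toℕ k))
sumToᶜ≡sum zero f = sym (+ᶜ-identityʳ (f 0))
sumToᶜ≡sum (suc n) f = trans (sumToᶜ-suc n f) (cong (f 0 +ᶜ_) (sumToᶜ≡sum n (λ k → f (suc k))))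

binomial : ∀ n z w → (z +ᶜ w) ^ᶜ n ≡ ∑[ k ≤ n ] (fromℕ (n C k) *ᶜ (z ^ᶜ (n ∸ k) *ᶜ w ^ᶜ k))
binomial n z w = begin
  (z +ᶜ w) ^ᶜ n                                     ≡⟨ trans (cong (_^ᶜ n) (+ᶜ-comm z w)) (^ᶜ≡^ (w +ᶜ z) n) ⟩
  (w +ᶜ z) ^ n                                      ≡⟨ Binomial.theorem n w z ⟩
  sum {suc n} (λ k → term (toℕ k))                  ≡⟨ sym (sumToᶜ≡sum n term) ⟩
  ∑[ k ≤ n ] term k                                 ≡⟨ sumToᶜ-cong n (λ k _ → reorder k) ⟩
  ∑[ k ≤ n ] (fromℕ (n C k) *ᶜ (z ^ᶜ (n ∸ k) *ᶜ w ^ᶜ k)) ∎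
  where
  open ≡-Reasoning
  term : ℕ → ℚi
  term k = (n C k) × (w ^ k *ᶜ z ^ (n ∸ k))
  reorder : ∀ k → term k ≡ fromℕ (n C k) *ᶜ (z ^ᶜ (n ∸ k) *ᶜ w ^ᶜ k)
  reorder k = trans (×≡fromℕ*ᶜ (n C k) _) (cong (fromℕ (n C k) *ᶜ_)
    (trans (*ᶜ-comm (w ^ k) (z ^ (n ∸ k))) (sym (cong₂ _*ᶜ_ (^ᶜ≡^ z (n ∸ k)) (^ᶜ≡^ w k)))))

m∸n∸o≡m∸o∸n : ∀ m n o → m ∸ n ∸ o ≡ m ∸ o ∸ n
m∸n∸o≡m∸o∸n m n o = trans (ℕ.∸-+-assoc m n o) (trans (cong (m ∸_) (ℕ.+-comm n o)) (sym (ℕ.∸-+-assoc m o n)))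

nCk*[k!*[n∸k]!]≡n! : ∀ {n k} → k ≤ n → (n C k) ℕ.* (k ! ℕ.* (n ∸ k) !) ≡ n !
nCk*[k!*[n∸k]!]≡n! {n} {k} k≤n = trans (cong (ℕ._* (k ! ℕ.* (n ∸ k) !)) (nCk≡n!/k![n-k]! k≤n))
  (m/n*n≡m {{ℕ._!*_!≢0 k (n ∸ k)}} (k![n∸k]!∣n! k≤n))

nCk*[n∸k]Cj*[k!*j!*[n∸k∸j]!]≡n! : ∀ n k j → k ℕ.+ j ≤ n →
  (n C k) ℕ.* ((n ∸ k) C j) ℕ.* (k ! ℕ.* j ! ℕ.* (n ∸ k ∸ j) !) ≡ n !
nCk*[n∸k]Cj*[k!*j!*[n∸k∸j]!]≡n! n k j k+j≤n = begin
  (n C k) ℕ.* ((n ∸ k) C j) ℕ.* (k ! ℕ.* j ! ℕ.* (n ∸ k ∸ j) !)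
    ≡⟨ regroup (n C k) ((n ∸ k) C j) (k !) (j !) ((n ∸ k ∸ j) !) ⟩
  (n C k) ℕ.* (k ! ℕ.* (((n ∸ k) C j) ℕ.* (j ! ℕ.* (n ∸ k ∸ j) !)))
    ≡⟨ cong (λ m → (n C k) ℕ.* (k ! ℕ.* m)) (nCk*[k!*[n∸k]!]≡n! (ℕ.m+n≤o⇒m≤o∸n j (subst (_≤ n) (ℕ.+-comm k j) k+j≤n))) ⟩
  (n C k) ℕ.* (k ! ℕ.* (n ∸ k) !)
    ≡⟨ nCk*[k!*[n∸k]!]≡n! (ℕ.m+n≤o⇒m≤o k k+j≤n) ⟩
  n ! ∎
  where
  open ≡-Reasoning
  regroup : ∀ a b c d e → a ℕ.* b ℕ.* (c ℕ.* d ℕ.* e) ≡ a ℕ.* (c ℕ.* (b ℕ.* (d ℕ.* e)))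
  regroup = ℕ-solve-∀

nCk*[n∸k]Cj≡nCj*[n∸j]Ck : ∀ n k j → k ℕ.+ j ≤ n → (n C k) ℕ.* ((n ∸ k) C j) ≡ (n C j) ℕ.* ((n ∸ j) C k)
nCk*[n∸k]Cj≡nCj*[n∸j]Ck n k j k+j≤n = ℕ.*-cancelʳ-≡ _ _ (k ! ℕ.* j ! ℕ.* (n ∸ k ∸ j) !)
  {{ℕ.m*n≢0 _ _ {{ℕ._!*_!≢0 k j}} {{(n ∸ k ∸ j) ℕ.!≢0}}}}
  (trans (nCk*[n∸k]Cj*[k!*j!*[n∸k∸j]!]≡n! n k j k+j≤n) (sym (begin
    (n C j) ℕ.* ((n ∸ j) C k) ℕ.* (k ! ℕ.* j ! ℕ.* (n ∸ k ∸ j) !)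
      ≡⟨ cong₂ (λ a b → (n C j) ℕ.* ((n ∸ j) C k) ℕ.* (a ℕ.* b !)) (ℕ.*-comm (k !) (j !)) (m∸n∸o≡m∸o∸n n k j) ⟩
    (n C j) ℕ.* ((n ∸ j) C k) ℕ.* (j ! ℕ.* k ! ℕ.* (n ∸ j ∸ k) !)
      ≡⟨ nCk*[n∸k]Cj*[k!*j!*[n∸k∸j]!]≡n! n j k (subst (_≤ n) (ℕ.+-comm k j) k+j≤n) ⟩
    n ! ∎)))
  where open ≡-Reasoning

fromℕ-C-swap : ∀ n k j → k ℕ.+ j ≤ n →
               fromℕ (n C k) *ᶜ fromℕ ((n ∸ k) C j) ≡ fromℕ (n C j) *ᶜ fromℕ ((n ∸ j) C k)
fromℕ-C-swap n k j k+j≤n = trans (sym (fromℕ-homo-* (n C k) ((n ∸ k) C j)))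
  (trans (cong fromℕ (nCk*[n∸k]Cj≡nCj*[n∸j]Ck n k j k+j≤n)) (fromℕ-homo-* (n C j) ((n ∸ j) C k)))

-- Bernoulli polynomials over ℚ(i)

bernPolyᶜ : (ℕ → ℚi) → ℕ → ℚi → ℚi
bernPolyᶜ b n z = ∑[ k ≤ n ] (fromℕ (n C k) *ᶜ b k *ᶜ z ^ᶜ (n ∸ k))

bernPolyᶜ-+ : ∀ b n z w →
              bernPolyᶜ b n (z +ᶜ w) ≡ ∑[ k ≤ n ] (fromℕ (n C k) *ᶜ bernPolyᶜ b (n ∸ k) z *ᶜ w ^ᶜ k)
bernPolyᶜ-+ b n z w = begin
  bernPolyᶜ b n (z +ᶜ w)
    ≡⟨ sumToᶜ-cong n (λ j _ → trans (cong (fromℕ (n C j) *ᶜ b j *ᶜ_) (binomial (n ∸ j) z w))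
                                     (*ᶜ-distribˡ-sumToᶜ (n ∸ j) (fromℕ (n C j) *ᶜ b j) _)) ⟩
  ∑[ j ≤ n ] ∑[ k ≤ n ∸ j ] G j k
    ≡⟨ sumToᶜ-triangle n G ⟩
  ∑[ k ≤ n ] ∑[ j ≤ n ∸ k ] G j k
    ≡⟨ sumToᶜ-cong n (λ k k≤n → sumToᶜ-cong (n ∸ k) (λ j j≤n∸k → reindex k j (ℕ.m≤o∸n⇒m+n≤o j k≤n j≤n∸k))) ⟩
  ∑[ k ≤ n ] ∑[ j ≤ n ∸ k ] (fromℕ (n C k) *ᶜ t k j *ᶜ w ^ᶜ k)
    ≡⟨ sym (sumToᶜ-cong n (λ k _ → trans (cong (_*ᶜ w ^ᶜ k) (*ᶜ-distribˡ-sumToᶜ (n ∸ k) (fromℕ (n C k)) (t k)))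
                                          (*ᶜ-distribʳ-sumToᶜ (n ∸ k) (w ^ᶜ k) _))) ⟩
  ∑[ k ≤ n ] (fromℕ (n C k) *ᶜ bernPolyᶜ b (n ∸ k) z *ᶜ w ^ᶜ k) ∎
  where
  open ≡-Reasoning
  G : ℕ → ℕ → ℚi
  G j k = fromℕ (n C j) *ᶜ b j *ᶜ (fromℕ ((n ∸ j) C k) *ᶜ (z ^ᶜ (n ∸ j ∸ k) *ᶜ w ^ᶜ k))
  t : ℕ → ℕ → ℚi
  t k j = fromℕ ((n ∸ k) C j) *ᶜ b j *ᶜ z ^ᶜ (n ∸ k ∸ j)
  regroup : ∀ a b c d e → a *ᶜ b *ᶜ (c *ᶜ (d *ᶜ e)) ≡ (a *ᶜ c) *ᶜ (b *ᶜ d *ᶜ e)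
  regroup = solve-∀ ℚi-ring
  reindex : ∀ k j → j ℕ.+ k ≤ n → G j k ≡ fromℕ (n C k) *ᶜ t k j *ᶜ w ^ᶜ k
  reindex k j j+k≤n = begin
    G j k
      ≡⟨ regroup (fromℕ (n C j)) (b j) (fromℕ ((n ∸ j) C k)) (z ^ᶜ (n ∸ j ∸ k)) (w ^ᶜ k) ⟩
    (fromℕ (n C j) *ᶜ fromℕ ((n ∸ j) C k)) *ᶜ (b j *ᶜ z ^ᶜ (n ∸ j ∸ k) *ᶜ w ^ᶜ k)
      ≡⟨ cong₂ (λ c m → c *ᶜ (b j *ᶜ z ^ᶜ m *ᶜ w ^ᶜ k)) (fromℕ-C-swap n j k j+k≤n) (m∸n∸o≡m∸o∸n n j k) ⟩
    (fromℕ (n C k) *ᶜ fromℕ ((n ∸ k) C j)) *ᶜ (b j *ᶜ z ^ᶜ (n ∸ k ∸ j) *ᶜ w ^ᶜ k)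
      ≡⟨ regroup′ (fromℕ (n C k)) (fromℕ ((n ∸ k) C j)) (b j) (z ^ᶜ (n ∸ k ∸ j)) (w ^ᶜ k) ⟩
    fromℕ (n C k) *ᶜ t k j *ᶜ w ^ᶜ k ∎
    where
    regroup′ : ∀ a c b d e → (a *ᶜ c) *ᶜ (b *ᶜ d *ᶜ e) ≡ a *ᶜ (c *ᶜ b *ᶜ d) *ᶜ e
    regroup′ = solve-∀ ℚi-ring

bernPolyᶜ-at-0 : ∀ b m → bernPolyᶜ b m 0ᶜ ≡ b m
bernPolyᶜ-at-0 b m = begin
  bernPolyᶜ b m 0ᶜ                                 ≡⟨ sumToᶜ-single m _ ℕ.≤-refl vanish ⟩
  fromℕ (m C m) *ᶜ b m *ᶜ 0ᶜ ^ᶜ (m ∸ m)            ≡⟨ cong₂ (λ c e → fromℕ c *ᶜ b m *ᶜ 0ᶜ ^ᶜ e) (nCn≡1 m) (ℕ.n∸n≡0 m) ⟩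
  1ᶜ *ᶜ b m *ᶜ 1ᶜ                                  ≡⟨ unit (b m) ⟩
  b m                                              ∎
  where
  open ≡-Reasoning
  unit : ∀ a → 1ᶜ *ᶜ a *ᶜ 1ᶜ ≡ a
  unit = solve-∀ ℚi-ring
  vanish : ∀ k → k ≤ m → k ≢ m → fromℕ (m C k) *ᶜ b k *ᶜ 0ᶜ ^ᶜ (m ∸ k) ≡ 0ᶜ
  vanish k k≤m k≢m = begin
    fromℕ (m C k) *ᶜ b k *ᶜ 0ᶜ ^ᶜ (m ∸ k)           ≡⟨ cong (λ e → fromℕ (m C k) *ᶜ b k *ᶜ 0ᶜ ^ᶜ e) (ℕ.+-∸-assoc 1 k<m) ⟩
    fromℕ (m C k) *ᶜ b k *ᶜ (0ᶜ *ᶜ 0ᶜ ^ᶜ (m ∸ suc k)) ≡⟨ cong (fromℕ (m C k) *ᶜ b k *ᶜ_) (*ᶜ-zeroˡ (0ᶜ ^ᶜ (m ∸ suc k))) ⟩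
    fromℕ (m C k) *ᶜ b k *ᶜ 0ᶜ                        ≡⟨ *ᶜ-zeroʳ (fromℕ (m C k) *ᶜ b k) ⟩
    0ᶜ                                                ∎
    where
    k<m : k < m
    k<m = ℕ.≤∧≢⇒< k≤m k≢m

bernPolyᶜ-at-1 : ∀ b m → bernPolyᶜ b m 1ᶜ ≡ ∑[ k ≤ m ] (fromℕ (m C k) *ᶜ b k)
bernPolyᶜ-at-1 b m = sumToᶜ-cong m (λ k _ →
  trans (cong (fromℕ (m C k) *ᶜ b k *ᶜ_) (1ᶜ^n≡1ᶜ (m ∸ k))) (*ᶜ-identityʳ (fromℕ (m C k) *ᶜ b k)))

module Bernoulli (b : ℕ → ℚi) (b₀ : b 0 ≡ 1ᶜ)
                 (rec : ∀ m → ∑[ k ≤ suc m ] (fromℕ (suc (suc m) C k) *ᶜ b k) ≡ 0ᶜ) where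

  bernPolyᶜ-at-1≡at-0 : ∀ m → m ≢ 1 → bernPolyᶜ b m 1ᶜ ≡ bernPolyᶜ b m 0ᶜ
  bernPolyᶜ-at-1≡at-0 zero _ = refl
  bernPolyᶜ-at-1≡at-0 (suc zero) m≢1 = contradiction refl m≢1
  bernPolyᶜ-at-1≡at-0 (suc (suc m)) _ = begin
    bernPolyᶜ b M 1ᶜ                                                    ≡⟨ bernPolyᶜ-at-1 b M ⟩
    ∑[ k ≤ suc m ] (fromℕ (M C k) *ᶜ b k) +ᶜ fromℕ (M C M) *ᶜ b M       ≡⟨ cong₂ (λ s c → s +ᶜ fromℕ c *ᶜ b M) (rec m) (nCn≡1 M) ⟩
    0ᶜ +ᶜ 1ᶜ *ᶜ b M                                                     ≡⟨ unit (b M) ⟩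
    b M                                                                 ≡⟨ sym (bernPolyᶜ-at-0 b M) ⟩
    bernPolyᶜ b M 0ᶜ                                                    ∎
    where
    open ≡-Reasoning
    M : ℕ
    M = suc (suc m)
    unit : ∀ a → 0ᶜ +ᶜ 1ᶜ *ᶜ a ≡ a
    unit = solve-∀ ℚi-ring

  bernPolyᶜ₁-at-1 : bernPolyᶜ b 1 1ᶜ ≡ bernPolyᶜ b 1 0ᶜ +ᶜ 1ᶜ
  bernPolyᶜ₁-at-1 rewrite b₀ = shape (b 1)
    where
    shape : ∀ a → 1ᶜ *ᶜ 1ᶜ *ᶜ (1ᶜ *ᶜ 1ᶜ) +ᶜ 1ᶜ *ᶜ a *ᶜ 1ᶜ ≡ (1ᶜ *ᶜ 1ᶜ *ᶜ (0ᶜ *ᶜ 1ᶜ) +ᶜ 1ᶜ *ᶜ a *ᶜ 1ᶜ) +ᶜ 1ᶜ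
    shape = solve-∀ ℚi-ring

  -- Expanding around 1 and around 0 by bernPolyᶜ-+, the two sums differ only where B_{N−k}(1) ≠ B_{N−k}(0),
  -- i.e. at N − k = 1.
  bernPolyᶜ-step : ∀ n z → bernPolyᶜ b (suc n) (z +ᶜ 1ᶜ) ≡ bernPolyᶜ b (suc n) z +ᶜ fromℕ (suc n) *ᶜ z ^ᶜ n
  bernPolyᶜ-step n z = begin
    bernPolyᶜ b N (z +ᶜ 1ᶜ)          ≡⟨ trans (cong (bernPolyᶜ b N) (+ᶜ-comm z 1ᶜ)) (bernPolyᶜ-+ b N 1ᶜ z) ⟩
    sumToᶜ N (term 1ᶜ)               ≡⟨ sumToᶜ-differ N (term 1ᶜ) (term 0ᶜ) (ℕ.n≤1+n n) agree ⟩
    sumToᶜ N (term 0ᶜ) +ᶜ (term 1ᶜ n -ᶜ term 0ᶜ n)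
      ≡⟨ cong₂ _+ᶜ_ (trans (sym (bernPolyᶜ-+ b N 0ᶜ z)) (cong (bernPolyᶜ b N) (+ᶜ-identityˡ z))) jump ⟩
    bernPolyᶜ b N z +ᶜ fromℕ N *ᶜ z ^ᶜ n ∎
    where
    open ≡-Reasoning
    N : ℕ
    N = suc n
    term : ℚi → ℕ → ℚi
    term a k = fromℕ (N C k) *ᶜ bernPolyᶜ b (N ∸ k) a *ᶜ z ^ᶜ k
    agree : ∀ k → k ≤ N → k ≢ n → term 1ᶜ k ≡ term 0ᶜ k
    agree k k≤N k≢n = cong (λ p → fromℕ (N C k) *ᶜ p *ᶜ z ^ᶜ k) (bernPolyᶜ-at-1≡at-0 (N ∸ k) N∸k≢1)
      where
      N∸k≢1 : N ∸ k ≢ 1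
      N∸k≢1 N∸k≡1 = k≢n (trans (sym (ℕ.m∸[m∸n]≡n k≤N)) (cong (N ∸_) N∸k≡1))
    jump : term 1ᶜ n -ᶜ term 0ᶜ n ≡ fromℕ N *ᶜ z ^ᶜ n
    jump = begin
      term 1ᶜ n -ᶜ term 0ᶜ n
        ≡⟨ cong₂ (λ c m → fromℕ c *ᶜ bernPolyᶜ b m 1ᶜ *ᶜ z ^ᶜ n -ᶜ fromℕ c *ᶜ bernPolyᶜ b m 0ᶜ *ᶜ z ^ᶜ n)
                 NCn≡N (ℕ.m+n∸n≡m 1 n) ⟩
      fromℕ N *ᶜ bernPolyᶜ b 1 1ᶜ *ᶜ z ^ᶜ n -ᶜ fromℕ N *ᶜ bernPolyᶜ b 1 0ᶜ *ᶜ z ^ᶜ n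
        ≡⟨ cong (λ p → fromℕ N *ᶜ p *ᶜ z ^ᶜ n -ᶜ fromℕ N *ᶜ bernPolyᶜ b 1 0ᶜ *ᶜ z ^ᶜ n) bernPolyᶜ₁-at-1 ⟩
      fromℕ N *ᶜ (bernPolyᶜ b 1 0ᶜ +ᶜ 1ᶜ) *ᶜ z ^ᶜ n -ᶜ fromℕ N *ᶜ bernPolyᶜ b 1 0ᶜ *ᶜ z ^ᶜ n
        ≡⟨ difference (fromℕ N) (bernPolyᶜ b 1 0ᶜ) (z ^ᶜ n) ⟩
      fromℕ N *ᶜ z ^ᶜ n ∎
      where
      NCn≡N : N C n ≡ N
      NCn≡N = trans (nCk≡nC[n∸k] (ℕ.n≤1+n n)) (trans (cong (N C_) (ℕ.m+n∸n≡m 1 n)) (nC1≡n N))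
      difference : ∀ c p x → c *ᶜ (p +ᶜ 1ᶜ) *ᶜ x +ᶜ negᶜ (c *ᶜ p *ᶜ x) ≡ c *ᶜ x
      difference = solve-∀ ℚi-ring

-- Fourth roots of unity

∑μ₄ : (ℚi → ℚi) → ℚi
∑μ₄ f = f 1ᶜ +ᶜ f iᶜ +ᶜ f (negᶜ 1ᶜ) +ᶜ f (negᶜ iᶜ)

∑μ₄-cong : ∀ {f g : ℚi → ℚi} → (∀ r → f r ≡ g r) → ∑μ₄ f ≡ ∑μ₄ g
∑μ₄-cong f≡g = cong₂ _+ᶜ_ (cong₂ _+ᶜ_ (cong₂ _+ᶜ_ (f≡g 1ᶜ) (f≡g iᶜ)) (f≡g (negᶜ 1ᶜ))) (f≡g (negᶜ iᶜ))

*ᶜ-distribˡ-∑μ₄ : ∀ c f → c *ᶜ ∑μ₄ f ≡ ∑μ₄ (λ r → c *ᶜ f r)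
*ᶜ-distribˡ-∑μ₄ c f = distrib c (f 1ᶜ) (f iᶜ) (f (negᶜ 1ᶜ)) (f (negᶜ iᶜ))
  where
  distrib : ∀ c a b d e → c *ᶜ (a +ᶜ b +ᶜ d +ᶜ e) ≡ c *ᶜ a +ᶜ c *ᶜ b +ᶜ c *ᶜ d +ᶜ c *ᶜ e
  distrib = solve-∀ ℚi-ring

sumToᶜ-∑μ₄ : ∀ n (F : ℕ → ℚi → ℚi) → ∑[ k ≤ n ] ∑μ₄ (F k) ≡ ∑μ₄ (λ r → ∑[ k ≤ n ] F k r)
sumToᶜ-∑μ₄ zero F = refl
sumToᶜ-∑μ₄ (suc n) F = trans (cong (_+ᶜ ∑μ₄ (F (suc n))) (sumToᶜ-∑μ₄ n F))
  (interchange (sumToᶜ n (λ k → F k 1ᶜ)) (sumToᶜ n (λ k → F k iᶜ)) (sumToᶜ n (λ k → F k (negᶜ 1ᶜ)))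
               (sumToᶜ n (λ k → F k (negᶜ iᶜ)))
               (F (suc n) 1ᶜ) (F (suc n) iᶜ) (F (suc n) (negᶜ 1ᶜ)) (F (suc n) (negᶜ iᶜ)))
  where
  interchange : ∀ a b c d a′ b′ c′ d′ →
                (a +ᶜ b +ᶜ c +ᶜ d) +ᶜ (a′ +ᶜ b′ +ᶜ c′ +ᶜ d′) ≡ (a +ᶜ a′) +ᶜ (b +ᶜ b′) +ᶜ (c +ᶜ c′) +ᶜ (d +ᶜ d′)
  interchange = solve-∀ ℚi-ring

1+i ½ ¼ ⅛ : ℚi
1+i = 1ᶜ +ᶜ iᶜ
½ = ι (+ 1 ℚ./ 2)
¼ = ι (+ 1 ℚ./ 4)
⅛ = ι (+ 1 ℚ./ 8)

r⁴≡1⇒r^[4+k]≡r^k : ∀ r → r ^ᶜ 4 ≡ 1ᶜ → ∀ k → r ^ᶜ (4 ℕ.+ k) ≡ r ^ᶜ k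
r⁴≡1⇒r^[4+k]≡r^k r r⁴≡1 k = trans (regroup r (r ^ᶜ k)) (trans (cong (_*ᶜ r ^ᶜ k) r⁴≡1) (*ᶜ-identityˡ (r ^ᶜ k)))
  where
  regroup : ∀ r x → r *ᶜ (r *ᶜ (r *ᶜ (r *ᶜ x))) ≡ (r *ᶜ (r *ᶜ (r *ᶜ (r *ᶜ 1ᶜ)))) *ᶜ x
  regroup = solve-∀ ℚi-ring

does-4∣?-4+ : ∀ k → does (4 ∣? (4 ℕ.+ k)) ≡ does (4 ∣? k)
does-4∣?-4+ k = does-⇔ (mk⇔ (λ 4∣4+k → ∣m+n∣m⇒∣n 4∣4+k ∣-refl) (∣m∣n⇒∣m+n ∣-refl)) (4 ∣? (4 ℕ.+ k)) (4 ∣? k)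

∑μ₄-^ : ∀ k → ∑μ₄ (λ r → r ^ᶜ k) ≡ (if does (4 ∣? k) then fromℕ 4 else 0ᶜ)
∑μ₄-^ 0 = refl
∑μ₄-^ 1 = refl
∑μ₄-^ 2 = refl
∑μ₄-^ 3 = refl
∑μ₄-^ (suc (suc (suc (suc k)))) = begin
  ∑μ₄ (λ r → r ^ᶜ (4 ℕ.+ k))
    ≡⟨ cong₂ _+ᶜ_ (cong₂ _+ᶜ_ (cong₂ _+ᶜ_ (r⁴≡1⇒r^[4+k]≡r^k 1ᶜ refl k) (r⁴≡1⇒r^[4+k]≡r^k iᶜ refl k)) (r⁴≡1⇒r^[4+k]≡r^k (negᶜ 1ᶜ) refl k))
                  (r⁴≡1⇒r^[4+k]≡r^k (negᶜ iᶜ) refl k) ⟩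
  ∑μ₄ (λ r → r ^ᶜ k)                                ≡⟨ ∑μ₄-^ k ⟩
  (if does (4 ∣? k) then fromℕ 4 else 0ᶜ)           ≡⟨ cong (λ b → if b then fromℕ 4 else 0ᶜ) (sym (does-4∣?-4+ k)) ⟩
  (if does (4 ∣? (4 ℕ.+ k)) then fromℕ 4 else 0ᶜ)   ∎
  where open ≡-Reasoning

-- Written exactly as in lhs, so that lhs unfolds to it.
coeff : ℕ → ℚ
coeff k = ((ℚ.- 1ℚ) ^ℚ (k ℕ./ 4)) ℚ.* (ℕ→ℚ 2 ^ℚ ((k ℕ./ 2) ∸ 1)) ℚ.- 1ℚ

ι[-1]^[m+1]*2^[2m+1] : ∀ m → ι ((ℚ.- 1ℚ) ^ℚ suc m ℚ.* ℕ→ℚ 2 ^ℚ suc (m ℕ.* 2)) ≡ ½ *ᶜ 1+i ^ᶜ (suc m ℕ.* 4)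
ι[-1]^[m+1]*2^[2m+1] zero = refl
ι[-1]^[m+1]*2^[2m+1] (suc m) = begin
  ι ((ℚ.- 1ℚ ℚ.* a) ℚ.* (ℕ→ℚ 2 ℚ.* (ℕ→ℚ 2 ℚ.* c)))
    ≡⟨ cong ι (solve 4 (λ s t a c → (s :* a) :* (t :* (t :* c)) := (s :* (t :* t)) :* (a :* c)) refl (ℚ.- 1ℚ) (ℕ→ℚ 2) a c) ⟩
  ι ((ℚ.- 1ℚ ℚ.* (ℕ→ℚ 2 ℚ.* ℕ→ℚ 2)) ℚ.* (a ℚ.* c))
    ≡⟨ ι-* (ℚ.- 1ℚ ℚ.* (ℕ→ℚ 2 ℚ.* ℕ→ℚ 2)) (a ℚ.* c) ⟩
  1+i ^ᶜ 4 *ᶜ ι (a ℚ.* c)                          ≡⟨ cong (1+i ^ᶜ 4 *ᶜ_) (ι[-1]^[m+1]*2^[2m+1] m) ⟩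
  1+i ^ᶜ 4 *ᶜ (½ *ᶜ 1+i ^ᶜ (suc m ℕ.* 4))          ≡⟨ regroup 1+i ½ (1+i ^ᶜ (suc m ℕ.* 4)) ⟩
  ½ *ᶜ 1+i ^ᶜ (suc (suc m) ℕ.* 4)                  ∎
  where
  open ≡-Reasoning
  a c : ℚ
  a = (ℚ.- 1ℚ) ^ℚ suc m
  c = ℕ→ℚ 2 ^ℚ suc (m ℕ.* 2)
  regroup : ∀ r h x → (r *ᶜ (r *ᶜ (r *ᶜ (r *ᶜ 1ᶜ)))) *ᶜ (h *ᶜ x) ≡ h *ᶜ (r *ᶜ (r *ᶜ (r *ᶜ (r *ᶜ x))))
  regroup = solve-∀ ℚi-ring

ι-coeff : ∀ m → ι (coeff (suc m ℕ.* 4)) ≡ ½ *ᶜ 1+i ^ᶜ (suc m ℕ.* 4) -ᶜ 1ᶜ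
ι-coeff m = trans (cong₂ (λ e f → ι (((ℚ.- 1ℚ) ^ℚ e) ℚ.* (ℕ→ℚ 2 ^ℚ (f ∸ 1)) ℚ.- 1ℚ)) (m*n/n≡m (suc m) 4) half)
                  (cong (_-ᶜ 1ᶜ) (ι[-1]^[m+1]*2^[2m+1] m))
  where
  half : suc m ℕ.* 4 ℕ./ 2 ≡ suc m ℕ.* 2
  half = trans (cong (ℕ._/ 2) (sym (ℕ.*-assoc (suc m) 2 2))) (m*n/n≡m (suc m ℕ.* 2) 2)

-- For k ≥ 1 this is the coefficient of C(n,k) B_{n−k}(x) on the left-hand side (ι-sel-coeff):
-- ∑μ₄ (_^ᶜ k) is 4 or 0 according as 4 ∣ k, and (1+i)⁴ = −4 makes (−1)^(k/4) 2^(k/2−1) = ½ (1+i)ᵏ.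
weight : ℕ → ℚi
weight k = ⅛ *ᶜ ∑μ₄ (λ r → (r *ᶜ 1+i) ^ᶜ k) -ᶜ ¼ *ᶜ ∑μ₄ (λ r → r ^ᶜ k)

weight-0 : weight 0 ≡ negᶜ ½
weight-0 = refl

weight-factor : ∀ k → weight k ≡ ∑μ₄ (λ r → r ^ᶜ k) *ᶜ (⅛ *ᶜ 1+i ^ᶜ k -ᶜ ¼)
weight-factor k = begin
  ⅛ *ᶜ ∑μ₄ (λ r → (r *ᶜ 1+i) ^ᶜ k) -ᶜ ¼ *ᶜ s
    ≡⟨ cong (λ t → ⅛ *ᶜ t -ᶜ ¼ *ᶜ s) (trans (∑μ₄-cong (λ r → trans (^ᶜ-distrib-*ᶜ r 1+i k) (*ᶜ-comm (r ^ᶜ k) (1+i ^ᶜ k))))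
                                              (sym (*ᶜ-distribˡ-∑μ₄ (1+i ^ᶜ k) (_^ᶜ k)))) ⟩
  ⅛ *ᶜ (1+i ^ᶜ k *ᶜ s) -ᶜ ¼ *ᶜ s  ≡⟨ factor ⅛ ¼ (1+i ^ᶜ k) s ⟩
  s *ᶜ (⅛ *ᶜ 1+i ^ᶜ k -ᶜ ¼)       ∎
  where
  open ≡-Reasoning
  s : ℚi
  s = ∑μ₄ (λ r → r ^ᶜ k)
  factor : ∀ e q x s → e *ᶜ (x *ᶜ s) +ᶜ negᶜ (q *ᶜ s) ≡ s *ᶜ (e *ᶜ x +ᶜ negᶜ q)
  factor = solve-∀ ℚi-ring

ι-sel-coeff : ∀ k q → ι (sel (suc k) (q ℚ.* coeff (suc k))) ≡ ι q *ᶜ weight (suc k)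
ι-sel-coeff k q = begin
  ι (sel (suc k) (q ℚ.* coeff (suc k)))
    ≡⟨ filtered (4 ∣? suc k) ⟩
  ι q *ᶜ ((if does (4 ∣? suc k) then fromℕ 4 else 0ᶜ) *ᶜ (⅛ *ᶜ 1+i ^ᶜ suc k -ᶜ ¼))
    ≡⟨ cong (λ s → ι q *ᶜ (s *ᶜ (⅛ *ᶜ 1+i ^ᶜ suc k -ᶜ ¼))) (sym (∑μ₄-^ (suc k))) ⟩
  ι q *ᶜ (∑μ₄ (λ r → r ^ᶜ suc k) *ᶜ (⅛ *ᶜ 1+i ^ᶜ suc k -ᶜ ¼))
    ≡⟨ cong (ι q *ᶜ_) (sym (weight-factor (suc k))) ⟩
  ι q *ᶜ weight (suc k) ∎
  where
  open ≡-Reasoning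
  filtered : (d : Dec (4 ∣ suc k)) → ι (if does d then q ℚ.* coeff (suc k) else 0ℚ)
                                     ≡ ι q *ᶜ ((if does d then fromℕ 4 else 0ᶜ) *ᶜ (⅛ *ᶜ 1+i ^ᶜ suc k -ᶜ ¼))
  filtered (no _) = sym (trans (cong (ι q *ᶜ_) (*ᶜ-zeroˡ (⅛ *ᶜ 1+i ^ᶜ suc k -ᶜ ¼))) (*ᶜ-zeroʳ (ι q)))
  filtered (yes (divides (suc m) refl)) = begin
    ι (q ℚ.* coeff (suc m ℕ.* 4))              ≡⟨ ι-* q (coeff (suc m ℕ.* 4)) ⟩
    ι q *ᶜ ι (coeff (suc m ℕ.* 4))             ≡⟨ cong (ι q *ᶜ_) (ι-coeff m) ⟩
    ι q *ᶜ (½ *ᶜ x -ᶜ 1ᶜ)                      ≡⟨ cong (ι q *ᶜ_) (sym (distribute (fromℕ 4) ⅛ ¼ x)) ⟩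
    ι q *ᶜ (fromℕ 4 *ᶜ (⅛ *ᶜ x -ᶜ ¼))          ∎
    where
    x : ℚi
    x = 1+i ^ᶜ (suc m ℕ.* 4)
    distribute : ∀ f e q x → f *ᶜ (e *ᶜ x +ᶜ negᶜ q) ≡ (f *ᶜ e) *ᶜ x +ᶜ negᶜ (f *ᶜ q)
    distribute = solve-∀ ℚi-ring

bernPolyᶜ-weighted-sum : ∀ b n X →
  ∑[ k ≤ n ] (fromℕ (n C k) *ᶜ bernPolyᶜ b (n ∸ k) X *ᶜ weight k)
    ≡ ⅛ *ᶜ ∑μ₄ (λ r → bernPolyᶜ b n (X +ᶜ r *ᶜ 1+i)) -ᶜ ¼ *ᶜ ∑μ₄ (λ r → bernPolyᶜ b n (X +ᶜ r))
bernPolyᶜ-weighted-sum b n X = begin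
  ∑[ k ≤ n ] (c k *ᶜ weight k)
    ≡⟨ sumToᶜ-cong n (λ k _ → trans (distribute (c k) ⅛ ¼ (∑μ₄ (u k)) (∑μ₄ (v k)))
                                     (cong₂ (λ s t → ⅛ *ᶜ s -ᶜ ¼ *ᶜ t) (*ᶜ-distribˡ-∑μ₄ (c k) (u k))
                                                                        (*ᶜ-distribˡ-∑μ₄ (c k) (v k)))) ⟩
  ∑[ k ≤ n ] (⅛ *ᶜ ∑μ₄ (λ r → c k *ᶜ u k r) -ᶜ ¼ *ᶜ ∑μ₄ (λ r → c k *ᶜ v k r))
    ≡⟨ sumToᶜ-linear n ⅛ ¼ (λ k → ∑μ₄ (λ r → c k *ᶜ u k r)) (λ k → ∑μ₄ (λ r → c k *ᶜ v k r)) ⟩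
  ⅛ *ᶜ ∑[ k ≤ n ] ∑μ₄ (λ r → c k *ᶜ u k r) -ᶜ ¼ *ᶜ ∑[ k ≤ n ] ∑μ₄ (λ r → c k *ᶜ v k r)
    ≡⟨ cong₂ (λ s t → ⅛ *ᶜ s -ᶜ ¼ *ᶜ t) (sumToᶜ-∑μ₄ n (λ k r → c k *ᶜ u k r)) (sumToᶜ-∑μ₄ n (λ k r → c k *ᶜ v k r)) ⟩
  ⅛ *ᶜ ∑μ₄ (λ r → ∑[ k ≤ n ] (c k *ᶜ u k r)) -ᶜ ¼ *ᶜ ∑μ₄ (λ r → ∑[ k ≤ n ] (c k *ᶜ v k r))
    ≡⟨ sym (cong₂ (λ s t → ⅛ *ᶜ s -ᶜ ¼ *ᶜ t) (∑μ₄-cong (λ r → bernPolyᶜ-+ b n X (r *ᶜ 1+i)))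
                                            (∑μ₄-cong (λ r → bernPolyᶜ-+ b n X r))) ⟩
  ⅛ *ᶜ ∑μ₄ (λ r → bernPolyᶜ b n (X +ᶜ r *ᶜ 1+i)) -ᶜ ¼ *ᶜ ∑μ₄ (λ r → bernPolyᶜ b n (X +ᶜ r)) ∎
  where
  open ≡-Reasoning
  c : ℕ → ℚi
  c k = fromℕ (n C k) *ᶜ bernPolyᶜ b (n ∸ k) X
  u v : ℕ → ℚi → ℚi
  u k r = (r *ᶜ 1+i) ^ᶜ k
  v k r = r ^ᶜ k
  distribute : ∀ c e q s t → c *ᶜ (e *ᶜ s +ᶜ negᶜ (q *ᶜ t)) ≡ e *ᶜ (c *ᶜ s) +ᶜ negᶜ (q *ᶜ (c *ᶜ t))
  distribute = solve-∀ ℚi-ring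

-- The braces on the right-hand side of the theorem, for F z = zⁿ⁻¹.
bracket : (ℚi → ℚi) → ℚi → ℚi
bracket F X = fromℕ 2 *ᶜ F (X -ᶜ 1ᶜ) -ᶜ fromℕ 2 *ᶜ F X +ᶜ F (X +ᶜ iᶜ) +ᶜ F (X -ᶜ iᶜ)
              -ᶜ F (X -ᶜ 1ᶜ +ᶜ iᶜ) -ᶜ F (X -ᶜ 1ᶜ -ᶜ iᶜ)

μ₄-telescope : ∀ (P D : ℚi → ℚi) → (∀ z → P (z +ᶜ 1ᶜ) ≡ P z +ᶜ D z) → ∀ X →
  ⅛ *ᶜ ∑μ₄ (λ r → P (X +ᶜ r *ᶜ 1+i)) -ᶜ ¼ *ᶜ ∑μ₄ (λ r → P (X +ᶜ r)) ≡ negᶜ ½ *ᶜ P X +ᶜ ⅛ *ᶜ bracket D X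
μ₄-telescope P D step X = begin
  ⅛ *ᶜ ∑μ₄ (λ r → P (X +ᶜ r *ᶜ 1+i)) -ᶜ ¼ *ᶜ ∑μ₄ (λ r → P (X +ᶜ r))
    ≡⟨ cong₂ (λ a b → ⅛ *ᶜ a -ᶜ ¼ *ᶜ b)
         (cong₂ _+ᶜ_ (cong₂ _+ᶜ_ (cong₂ _+ᶜ_ (trans (step′ (shift₁ X iᶜ)) (cong (_+ᶜ D z₁) Pz₁))
                                            (cong P (shift₂ X iᶜ)))
                                 (cong P (shift₃ X iᶜ)))
                     (trans (step′ (shift₄ X iᶜ)) (cong (_+ᶜ D z₂) Pz₂)))
         (cong₂ _+ᶜ_ (cong₂ _+ᶜ_ (cong₂ _+ᶜ_ (trans (step X) (cong (_+ᶜ D X) PX)) Pz₁) refl) Pz₂) ⟩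
  ⅛ *ᶜ ((P z₃ +ᶜ D z₃ +ᶜ D z₁) +ᶜ P z₃ +ᶜ P z₄ +ᶜ (P z₄ +ᶜ D z₄ +ᶜ D z₂))
    -ᶜ ¼ *ᶜ ((P z₅ +ᶜ D z₅ +ᶜ D X) +ᶜ (P z₃ +ᶜ D z₃) +ᶜ P z₅ +ᶜ (P z₄ +ᶜ D z₄))
    ≡⟨ collect ⅛ (P z₃) (P z₄) (P z₅) (D z₁) (D z₂) (D z₃) (D z₄) (D z₅) (D X) ⟩
  negᶜ ½ *ᶜ (P z₅ +ᶜ D z₅) +ᶜ ⅛ *ᶜ bracket D X
    ≡⟨ cong (λ p → negᶜ ½ *ᶜ p +ᶜ ⅛ *ᶜ bracket D X) (sym PX) ⟩
  negᶜ ½ *ᶜ P X +ᶜ ⅛ *ᶜ bracket D X ∎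
  where
  open ≡-Reasoning
  z₁ z₂ z₃ z₄ z₅ : ℚi
  z₁ = X +ᶜ iᶜ
  z₂ = X -ᶜ iᶜ
  z₃ = X -ᶜ 1ᶜ +ᶜ iᶜ
  z₄ = X -ᶜ 1ᶜ -ᶜ iᶜ
  z₅ = X -ᶜ 1ᶜ
  step′ : ∀ {z w} → w ≡ z +ᶜ 1ᶜ → P w ≡ P z +ᶜ D z
  step′ {z} refl = step z
  shift₀ : ∀ X → X ≡ X +ᶜ negᶜ 1ᶜ +ᶜ 1ᶜ
  shift₀ = solve-∀ ℚi-ring
  shift₁ : ∀ X i → X +ᶜ (1ᶜ +ᶜ i) ≡ X +ᶜ i +ᶜ 1ᶜ
  shift₁ = solve-∀ ℚi-ring
  shift₂ : ∀ X i → X +ᶜ (negᶜ 1ᶜ +ᶜ i) ≡ X +ᶜ negᶜ 1ᶜ +ᶜ i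
  shift₂ = solve-∀ ℚi-ring
  shift₃ : ∀ X i → X +ᶜ (negᶜ 1ᶜ +ᶜ negᶜ i) ≡ X +ᶜ negᶜ 1ᶜ +ᶜ negᶜ i
  shift₃ = solve-∀ ℚi-ring
  shift₄ : ∀ X i → X +ᶜ (1ᶜ +ᶜ negᶜ i) ≡ X +ᶜ negᶜ i +ᶜ 1ᶜ
  shift₄ = solve-∀ ℚi-ring
  shift₅ : ∀ X i → X +ᶜ i ≡ X +ᶜ negᶜ 1ᶜ +ᶜ i +ᶜ 1ᶜ
  shift₅ = solve-∀ ℚi-ring
  shift₆ : ∀ X i → X +ᶜ negᶜ i ≡ X +ᶜ negᶜ 1ᶜ +ᶜ negᶜ i +ᶜ 1ᶜ
  shift₆ = solve-∀ ℚi-ring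
  PX : P X ≡ P z₅ +ᶜ D z₅
  PX = step′ (shift₀ X)
  Pz₁ : P z₁ ≡ P z₃ +ᶜ D z₃
  Pz₁ = step′ (shift₅ X iᶜ)
  Pz₂ : P z₂ ≡ P z₄ +ᶜ D z₄
  Pz₂ = step′ (shift₆ X iᶜ)
  collect : ∀ e p₃ p₄ p₅ d₁ d₂ d₃ d₄ d₅ d →
    e *ᶜ ((p₃ +ᶜ d₃ +ᶜ d₁) +ᶜ p₃ +ᶜ p₄ +ᶜ (p₄ +ᶜ d₄ +ᶜ d₂))
      +ᶜ negᶜ ((e +ᶜ e) *ᶜ ((p₅ +ᶜ d₅ +ᶜ d) +ᶜ (p₃ +ᶜ d₃) +ᶜ p₅ +ᶜ (p₄ +ᶜ d₄)))
    ≡ negᶜ (e +ᶜ e +ᶜ (e +ᶜ e)) *ᶜ (p₅ +ᶜ d₅)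
      +ᶜ e *ᶜ ((1ᶜ +ᶜ 1ᶜ) *ᶜ d₅ +ᶜ negᶜ ((1ᶜ +ᶜ 1ᶜ) *ᶜ d) +ᶜ d₁ +ᶜ d₂ +ᶜ negᶜ d₃ +ᶜ negᶜ d₄)
  collect = solve-∀ ℚi-ring

ι-bernPoly : ∀ B n x → ι (bernPoly B n x) ≡ bernPolyᶜ (λ k → ι (B k)) n (ι x)
ι-bernPoly B n x = trans (ι-sumTo n _) (sumToᶜ-cong n (λ k _ →
  trans (ι-* (ℕ→ℚ (n C k) ℚ.* B k) (x ^ℚ (n ∸ k)))
        (cong₂ _*ᶜ_ (ι-* (ℕ→ℚ (n C k)) (B k)) (ι-^ x (n ∸ k)))))

ι-lhs : ∀ B n x → ι (lhs B (suc n) x)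
        ≡ ∑[ k ≤ n ] (fromℕ (suc n C suc k) *ᶜ bernPolyᶜ (λ j → ι (B j)) (suc n ∸ suc k) (ι x) *ᶜ weight (suc k))
ι-lhs B n x = begin
  ι (lhs B N x)                         ≡⟨ ι-sumTo N summand ⟩
  ∑[ k ≤ N ] ι (summand k)              ≡⟨ sumToᶜ-suc n (λ k → ι (summand k)) ⟩
  0ᶜ +ᶜ ∑[ k ≤ n ] ι (summand (suc k))  ≡⟨ +ᶜ-identityˡ (∑[ k ≤ n ] ι (summand (suc k))) ⟩
  ∑[ k ≤ n ] ι (summand (suc k))        ≡⟨ sumToᶜ-cong n (λ k _ → trans (ι-sel-coeff k (q (suc k)))
                                                                        (cong (_*ᶜ weight (suc k)) (ι-q (suc k)))) ⟩
  ∑[ k ≤ n ] (fromℕ (N C suc k) *ᶜ bernPolyᶜ (λ j → ι (B j)) (N ∸ suc k) (ι x) *ᶜ weight (suc k)) ∎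
  where
  open ≡-Reasoning
  N : ℕ
  N = suc n
  q : ℕ → ℚ
  q k = ℕ→ℚ (N C k) ℚ.* bernPoly B (N ∸ k) x
  summand : ℕ → ℚ
  summand k = sel k (q k ℚ.* coeff k)
  ι-q : ∀ k → ι (q k) ≡ fromℕ (N C k) *ᶜ bernPolyᶜ (λ j → ι (B j)) (N ∸ k) (ι x)
  ι-q k = trans (ι-* (ℕ→ℚ (N C k)) (bernPoly B (N ∸ k) x)) (cong (fromℕ (N C k) *ᶜ_) (ι-bernPoly B (N ∸ k) x))

ι-bernoulli-rec : ∀ (B : ℕ → ℚ) → ((m : ℕ) → sumTo (suc m) (λ k → ℕ→ℚ (suc (suc m) C k) ℚ.* B k) ≡ 0ℚ) →
                  ∀ m → ∑[ k ≤ suc m ] (fromℕ (suc (suc m) C k) *ᶜ ι (B k)) ≡ 0ᶜ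
ι-bernoulli-rec B rec m = trans (sumToᶜ-cong (suc m) (λ k _ → sym (ι-* (ℕ→ℚ (suc (suc m) C k)) (B k))))
                                (trans (sym (ι-sumTo (suc m) (λ k → ℕ→ℚ (suc (suc m) C k) ℚ.* B k))) (cong ι (rec m)))

rhs≡bracket : ∀ n x → rhs (suc n) x ≡ ⅛ *ᶜ bracket (λ z → fromℕ (suc n) *ᶜ z ^ᶜ n) (ι x)
rhs≡bracket n x = trans (cong (_*ᶜ bracket (_^ᶜ n) X) (ι-* (ℕ→ℚ (suc n)) (+ 1 ℚ./ 8)))
  (linear (fromℕ (suc n)) ⅛ (fromℕ 2) (z₅ ^ᶜ n) (X ^ᶜ n) (z₁ ^ᶜ n) (z₂ ^ᶜ n) (z₃ ^ᶜ n) (z₄ ^ᶜ n))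
  where
  X z₁ z₂ z₃ z₄ z₅ : ℚi
  X = ι x
  z₁ = X +ᶜ iᶜ
  z₂ = X -ᶜ iᶜ
  z₃ = X -ᶜ 1ᶜ +ᶜ iᶜ
  z₄ = X -ᶜ 1ᶜ -ᶜ iᶜ
  z₅ = X -ᶜ 1ᶜ
  linear : ∀ c e t d₅ d d₁ d₂ d₃ d₄ →
    (c *ᶜ e) *ᶜ (t *ᶜ d₅ +ᶜ negᶜ (t *ᶜ d) +ᶜ d₁ +ᶜ d₂ +ᶜ negᶜ d₃ +ᶜ negᶜ d₄)
    ≡ e *ᶜ (t *ᶜ (c *ᶜ d₅) +ᶜ negᶜ (t *ᶜ (c *ᶜ d)) +ᶜ c *ᶜ d₁ +ᶜ c *ᶜ d₂ +ᶜ negᶜ (c *ᶜ d₃) +ᶜ negᶜ (c *ᶜ d₄))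
  linear = solve-∀ ℚi-ring

theorem2p5 : (B : ℕ → ℚ) → IsBernoulli B → (n : ℕ) → (x : ℚ) →
    ι (lhs B (suc n) x) ≡ rhs (suc n) x
theorem2p5 B (B₀ , rec) n x = +ᶜ-cancelˡ (negᶜ ½ *ᶜ P X) (ι (lhs B N x)) (rhs N x) (begin
  negᶜ ½ *ᶜ P X +ᶜ ι (lhs B N x)       ≡⟨ cong₂ _+ᶜ_ (sym term₀) (ι-lhs B n x) ⟩
  term 0 +ᶜ ∑[ k ≤ n ] term (suc k)   ≡⟨ sym (sumToᶜ-suc n term) ⟩
  ∑[ k ≤ N ] term k                   ≡⟨ bernPolyᶜ-weighted-sum b N X ⟩
  ⅛ *ᶜ ∑μ₄ (λ r → P (X +ᶜ r *ᶜ 1+i)) -ᶜ ¼ *ᶜ ∑μ₄ (λ r → P (X +ᶜ r))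
                                      ≡⟨ μ₄-telescope P (λ z → fromℕ N *ᶜ z ^ᶜ n) (bernPolyᶜ-step n) X ⟩
  negᶜ ½ *ᶜ P X +ᶜ ⅛ *ᶜ bracket (λ z → fromℕ N *ᶜ z ^ᶜ n) X
                                      ≡⟨ cong (negᶜ ½ *ᶜ P X +ᶜ_) (sym (rhs≡bracket n x)) ⟩
  negᶜ ½ *ᶜ P X +ᶜ rhs N x            ∎)
  where
  open ≡-Reasoning
  N : ℕ
  N = suc n
  X : ℚi
  X = ι x
  b : ℕ → ℚi
  b k = ι (B k)
  open Bernoulli b (cong ι B₀) (ι-bernoulli-rec B rec)
  P : ℚi → ℚi
  P = bernPolyᶜ b N
  term : ℕ → ℚi
  term k = fromℕ (N C k) *ᶜ bernPolyᶜ b (N ∸ k) X *ᶜ weight k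
  term₀ : term 0 ≡ negᶜ ½ *ᶜ P X
  term₀ = trans (cong (1ᶜ *ᶜ P X *ᶜ_) weight-0) (reorder (P X) ½)
    where
    reorder : ∀ p h → 1ᶜ *ᶜ p *ᶜ negᶜ h ≡ negᶜ h *ᶜ p
    reorder = solve-∀ ℚi-ring
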